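{- Let $a,b,c$ be three interior points of $\mathbb{T}\mathbb{P}^2$ which are tropically non-collinear. Then $(c\otimes a)\otimes(a\otimes b)\in\{ -(c\otimes a),\,-(a\otimes b),\,a\}$.
   Context: The tropical semifield is $\mathbb{T}=\mathbb{R}\cup\{ -\infty\}$ with $x\oplus y=\max\{x,y\}$, $x\odot y=x+y$. $\mathbb{T}\mathbb{P}^2$ is $(\mathbb{T}^3\setminus\{(-\infty,-\infty,-\infty)\})$ modulo adding a real multiple of $(1,1,1)$; classes are written $[x_1,x_2,x_3]$. A point is interior if all coordinates are real; for interior $u$, $-u:=[-u_1,-u_2,-u_3]$. A tropical line is a set $L_u=\{[x_1,x_2,x_3]:\max\{u_1+x_1,u_2+x_2,u_3+x_3\}\text{ attained at least twice}\}$ for interior $u$. Three points are tropically non-collinear if no tropical line contains all three. For interior $a,b$, $a\otimes b:=[\max\{a_2+b_3,b_2+a_3\},\max\{a_1+b_3,b_1+a_3\},\max\{a_1+b_2,b_1+a_2\}]$. (The affine plane $\mathbb{R}^2$ is identified with the interior of $\mathbb{T}\mathbb{P}^2$ via $(x,y)\mapsto[x,y,0]$, so the statement applies equally in the affine plane.) -}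

module Defs where

open import Level using (Level; 0ℓ) renaming (suc to lsuc)
open import Data.Product using (Σ; ∃; _×_; _,_)
open import Data.Sum using (_⊎_)
open import Relation.Nullary using (¬_; yes; no)
open import Relation.Binary.PropositionalEquality using (_≡_; _≢_)
open import Algebra.Structures using (IsCommutativeRing)
open import Relation.Binary.Structures using (IsDecTotalOrder)

-- The real numbers, axiomatised as a Dedekind-complete ordered field
-- (unique up to isomorphism).

record RealField : Set₁ where
  infixl 6 _+_
  infixl 7 _*_
  infix  4 _≤_
  field
    Carrier : Set
    _+_ _*_ : Carrier → Carrier → Carrier
    -_      : Carrier → Carrier
    0# 1#   : Carrier
    _≤_     : Carrier → Carrier → Set
    isCommutativeRing : IsCommutativeRing _≡_ _+_ _*_ -_ 0# 1#
    0≢1     : 0# ≢ 1#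
    *-inverse : ∀ x → x ≢ 0# → ∃ λ y → x * y ≡ 1#
    isDecTotalOrder : IsDecTotalOrder _≡_ _≤_
    +-monoˡ-≤ : ∀ {x y} z → x ≤ y → x + z ≤ y + z
    *-nonneg  : ∀ {x y} → 0# ≤ x → 0# ≤ y → 0# ≤ x * y
    complete  : (P : Carrier → Set) → ∃ P →
                (∃ λ b → ∀ x → P x → x ≤ b) →
                ∃ λ s → (∀ x → P x → x ≤ s) ×
                        (∀ b → (∀ x → P x → x ≤ b) → s ≤ b)

  open IsDecTotalOrder isDecTotalOrder public using (_≤?_)

  max : Carrier → Carrier → Carrier
  max x y with x ≤? y
  ... | yes _ = y
  ... | no  _ = x

-- Interior points of TP² are represented by triples of reals
-- (x₁, x₂, x₃); two triples represent the same point of TP² iff they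
-- differ by a real multiple of (1,1,1).

module _ (R : RealField) where
  open RealField R

  record Pt : Set where
    constructor [_,_,_]
    field
      x₁ x₂ x₃ : Carrier

  open Pt

  _≈ₚ_ : Pt → Pt → Set
  p ≈ₚ q = ∃ λ t → (x₁ q ≡ x₁ p + t) × (x₂ q ≡ x₂ p + t) × (x₃ q ≡ x₃ p + t)

  negₚ : Pt → Pt
  negₚ u = [ - x₁ u , - x₂ u , - x₃ u ]

  OnLine : Pt → Pt → Set
  OnLine u x =
    let s₁ = x₁ u + x₁ x
        s₂ = x₂ u + x₂ x
        s₃ = x₃ u + x₃ x
        m  = max (max s₁ s₂) s₃
    in (s₁ ≡ m × s₂ ≡ m) ⊎ (s₁ ≡ m × s₃ ≡ m) ⊎ (s₂ ≡ m × s₃ ≡ m)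

  NonCollinear : Pt → Pt → Pt → Set
  NonCollinear a b c = ¬ (∃ λ u → OnLine u a × OnLine u b × OnLine u c)

  _⊗_ : Pt → Pt → Pt
  a ⊗ b = [ max (x₂ a + x₃ b) (x₂ b + x₃ a)
          , max (x₁ a + x₃ b) (x₁ b + x₃ a)
          , max (x₁ a + x₂ b) (x₁ b + x₂ a) ]

{-# OPTIONS --safe #-}
module Submission where

-- Put p = c ⊗ a and q = a ⊗ b.  Both tropical lines L_p and L_q pass through a,
-- i.e. p ⊙ a and q ⊙ a attain their maximal coordinate at least twice.  Translating
-- by a multiplies p ⊗ q by the tropical adjugate of a, so it suffices to take a = 0:
-- for two such balanced points P, Q a case analysis on the position of their smaller
-- coordinate shows that P ⊗ Q is −P, −Q or the origin [0,0,0].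

open import Defs
open import Level using (0ℓ)
open import Data.Product using (∃; _×_; _,_)
open import Data.Sum using (_⊎_; inj₁; inj₂)
open import Relation.Nullary using (yes; no; contradiction)
open import Relation.Binary.PropositionalEquality
  using (_≡_; refl; sym; trans; cong; cong₂; subst; subst₂; module ≡-Reasoning)
open import Relation.Binary.Bundles using (DecTotalOrder)
open import Algebra.Bundles using (CommutativeRing)
open import Algebra.Construct.NaturalChoice.Base using (MaxOperator)
import Algebra.Construct.NaturalChoice.MaxOp as MaxOp
import Algebra.Properties.CommutativeSemigroup as CommutativeSemigroupProperties
import Algebra.Properties.AbelianGroup as AbelianGroupProperties

module TropicalPlane (R : RealField) where
  open RealField R

  decTotalOrder : DecTotalOrder 0ℓ 0ℓ 0ℓ
  decTotalOrder = record { isDecTotalOrder = isDecTotalOrder }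

  open DecTotalOrder decTotalOrder
    using (totalPreorder; antisym; total; reflexive)
    renaming (refl to ≤-refl; trans to ≤-trans)

  commutativeRing : CommutativeRing 0ℓ 0ℓ
  commutativeRing = record { isCommutativeRing = isCommutativeRing }

  open CommutativeRing commutativeRing
    using (+-comm; +-assoc; +-identityˡ; +-identityʳ; -‿inverseˡ; -‿inverseʳ;
           +-commutativeSemigroup; +-abelianGroup)
  open CommutativeSemigroupProperties +-commutativeSemigroup
    using (interchange; x∙yz≈y∙xz; x∙yz≈y∙zx; xy∙z≈x∙zy; xy∙z≈y∙zx; xy∙z≈y∙xz; xy∙z≈zy∙x)
  open AbelianGroupProperties +-abelianGroup using (⁻¹-∙-comm)

  x≤y⇒max≡y : ∀ {x y} → x ≤ y → max x y ≡ y
  x≤y⇒max≡y {x} {y} x≤y with x ≤? y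
  ... | yes _  = refl
  ... | no x≰y = contradiction x≤y x≰y

  y≤x⇒max≡x : ∀ {x y} → y ≤ x → max x y ≡ x
  y≤x⇒max≡x {x} {y} y≤x with x ≤? y
  ... | yes x≤y = antisym y≤x x≤y
  ... | no _    = refl

  maxOperator : MaxOperator totalPreorder
  maxOperator = record
    { _⊔_       = max
    ; x≤y⇒x⊔y≈y = x≤y⇒max≡y
    ; x≥y⇒x⊔y≈x = y≤x⇒max≡x
    }

  open MaxOp maxOperator using (mono-≤-distrib-⊔)
    renaming (⊔-comm to max-comm; ⊔-lub to max-lub)

  +-distribʳ-max : ∀ t x y → max x y + t ≡ max (x + t) (y + t)
  +-distribʳ-max t = mono-≤-distrib-⊔ (cong (_+ t)) (+-monoˡ-≤ t)

  +-mono-≤ : ∀ {a b c d} → a ≤ b → c ≤ d → a + c ≤ b + d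
  +-mono-≤ {a} {b} {c} {d} a≤b c≤d = ≤-trans (+-monoˡ-≤ c a≤b)
    (subst₂ _≤_ (+-comm c b) (+-comm d b) (+-monoˡ-≤ b c≤d))

  max-+-flip : ∀ a b c d → max (a + b) (c + d) ≡ max (d + c) (b + a)
  max-+-flip a b c d = trans (max-comm (a + b) (c + d)) (cong₂ max (+-comm c d) (+-comm a b))

  shift-by-common-summand : ∀ {x y z K L} → x + z ≡ K → y + z ≡ L → y ≡ x + (L + - K)
  shift-by-common-summand {x} {y} {z} refl refl = sym (begin
    x + ((y + z) + - (x + z))    ≡⟨ cong (λ w → x + ((y + z) + w)) (sym (⁻¹-∙-comm x z)) ⟩
    x + ((y + z) + (- x + - z))  ≡⟨ cong (x +_) (interchange y z (- x) (- z)) ⟩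
    x + ((y + - x) + (z + - z))  ≡⟨ cong (λ w → x + ((y + - x) + w)) (-‿inverseʳ z) ⟩
    x + ((y + - x) + 0#)         ≡⟨ cong (x +_) (+-identityʳ (y + - x)) ⟩
    x + (y + - x)                ≡⟨ x∙yz≈y∙xz x y (- x) ⟩
    y + (x + - x)                ≡⟨ cong (y +_) (-‿inverseʳ x) ⟩
    y + 0#                       ≡⟨ +-identityʳ y ⟩
    y                            ∎)
    where open ≡-Reasoning

  infixl 7 _⊗ᴿ_ _⊙_

  _⊗ᴿ_ : Pt R → Pt R → Pt R
  _⊗ᴿ_ = _⊗_ R

  _⊙_ : Pt R → Pt R → Pt R
  [ u₁ , u₂ , u₃ ] ⊙ [ v₁ , v₂ , v₃ ] = [ u₁ + v₁ , u₂ + v₂ , u₃ + v₃ ]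

  adjugate : Pt R → Pt R
  adjugate [ a₁ , a₂ , a₃ ] = [ a₂ + a₃ , a₁ + a₃ , a₁ + a₂ ]

  rotate : Pt R → Pt R
  rotate [ u₁ , u₂ , u₃ ] = [ u₂ , u₃ , u₁ ]

  pairwiseMax : Pt R → Pt R
  pairwiseMax [ u₁ , u₂ , u₃ ] = [ max u₂ u₃ , max u₁ u₃ , max u₁ u₂ ]

  Constant : Pt R → Set
  Constant [ u₁ , u₂ , u₃ ] = ∃ λ K → u₁ ≡ K × u₂ ≡ K × u₃ ≡ K

  pt-cong : ∀ {u₁ u₂ u₃ v₁ v₂ v₃} → u₁ ≡ v₁ → u₂ ≡ v₂ → u₃ ≡ v₃ →
            _≡_ {A = Pt R} [ u₁ , u₂ , u₃ ] [ v₁ , v₂ , v₃ ]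
  pt-cong refl refl refl = refl

  ⊙-comm : ∀ U V → U ⊙ V ≡ V ⊙ U
  ⊙-comm [ u₁ , u₂ , u₃ ] [ v₁ , v₂ , v₃ ] = pt-cong (+-comm u₁ v₁) (+-comm u₂ v₂) (+-comm u₃ v₃)

  ⊙-interchange : ∀ W X Y Z → (W ⊙ X) ⊙ (Y ⊙ Z) ≡ (W ⊙ Y) ⊙ (X ⊙ Z)
  ⊙-interchange [ w₁ , w₂ , w₃ ] [ x₁ , x₂ , x₃ ] [ y₁ , y₂ , y₃ ] [ z₁ , z₂ , z₃ ] =
    pt-cong (interchange w₁ x₁ y₁ z₁) (interchange w₂ x₂ y₂ z₂) (interchange w₃ x₃ y₃ z₃)

  ⊙-constant⇒≈ₚ : ∀ X Y Z → Constant (X ⊙ Z) → Constant (Y ⊙ Z) → _≈ₚ_ R X Y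
  ⊙-constant⇒≈ₚ [ _ , _ , _ ] [ _ , _ , _ ] [ _ , _ , _ ] (K , e₁ , e₂ , e₃) (L , f₁ , f₂ , f₃) =
    L + - K , shift-by-common-summand e₁ f₁
            , shift-by-common-summand e₂ f₂
            , shift-by-common-summand e₃ f₃

  constant-⊙-cancelʳ : ∀ U C → Constant (U ⊙ C) → Constant C → Constant U
  constant-⊙-cancelʳ [ _ , _ , _ ] [ c₁ , c₂ , c₃ ] (K , e₁ , e₂ , e₃) (L , f₁ , f₂ , f₃) =
    0# + (K + - L) , cancel c₁ e₁ f₁ , cancel c₂ e₂ f₂ , cancel c₃ e₃ f₃
    where
    cancel : ∀ {u} c → u + c ≡ K → c ≡ L → u ≡ 0# + (K + - L)
    cancel c u+c≡K c≡L = shift-by-common-summand (trans (+-identityˡ c) c≡L) u+c≡K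

  negₚ-⊙-constant : ∀ X → Constant (negₚ R X ⊙ X)
  negₚ-⊙-constant [ x₁ , x₂ , x₃ ] = 0# , -‿inverseˡ x₁ , -‿inverseˡ x₂ , -‿inverseˡ x₃

  ⊙-adjugate-constant : ∀ a → Constant (a ⊙ adjugate a)
  ⊙-adjugate-constant [ a₁ , a₂ , a₃ ] =
    a₁ + (a₂ + a₃) , refl , x∙yz≈y∙xz a₂ a₁ a₃ , x∙yz≈y∙zx a₃ a₁ a₂

  constant-unrotate : ∀ X → Constant (rotate X) → Constant X
  constant-unrotate [ _ , _ , _ ] (K , e₂ , e₃ , e₁) = K , e₁ , e₂ , e₃

  ⊗-comm : ∀ P Q → P ⊗ᴿ Q ≡ Q ⊗ᴿ P
  ⊗-comm [ p₁ , p₂ , p₃ ] [ q₁ , q₂ , q₃ ] =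
    pt-cong (max-comm (p₂ + q₃) (q₂ + p₃))
            (max-comm (p₁ + q₃) (q₁ + p₃))
            (max-comm (p₁ + q₂) (q₁ + p₂))

  rotate-⊗ : ∀ P Q → rotate P ⊗ᴿ rotate Q ≡ rotate (P ⊗ᴿ Q)
  rotate-⊗ [ p₁ , p₂ , p₃ ] [ q₁ , q₂ , q₃ ] =
    pt-cong (max-+-flip p₃ q₁ q₃ p₁) (max-+-flip p₂ q₁ q₂ p₁) refl

  ⊗-⊙-adjugate : ∀ p q a → (p ⊙ a) ⊗ᴿ (q ⊙ a) ≡ (p ⊗ᴿ q) ⊙ adjugate a
  ⊗-⊙-adjugate [ p₁ , p₂ , p₃ ] [ q₁ , q₂ , q₃ ] [ a₁ , a₂ , a₃ ] =
    pt-cong (shift p₂ q₃ q₂ p₃ a₂ a₃) (shift p₁ q₃ q₁ p₃ a₁ a₃) (shift p₁ q₂ q₁ p₂ a₁ a₂)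
    where
    shift : ∀ w x y z s t →
            max ((w + s) + (x + t)) ((y + s) + (z + t)) ≡ max (w + x) (y + z) + (s + t)
    shift w x y z s t = sym (trans (+-distribʳ-max (s + t) (w + x) (y + z))
                                   (cong₂ max (interchange w x s t) (interchange y z s t)))

  ⊗-⊙-pairwiseMax : ∀ x y → (x ⊗ᴿ y) ⊙ y ≡ pairwiseMax (x ⊙ adjugate y)
  ⊗-⊙-pairwiseMax [ x₁ , x₂ , x₃ ] [ y₁ , y₂ , y₃ ] =
    pt-cong (shift (xy∙z≈x∙zy x₂ y₃ y₁) (xy∙z≈y∙zx y₂ x₃ y₁))
            (shift (xy∙z≈x∙zy x₁ y₃ y₂) (xy∙z≈y∙xz y₁ x₃ y₂))
            (shift (+-assoc x₁ y₂ y₃) (xy∙z≈y∙xz y₁ x₂ y₃))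
    where
    shift : ∀ {u v t u′ v′} → u + t ≡ u′ → v + t ≡ v′ → max u v + t ≡ max u′ v′
    shift {u} {v} {t} u+t≡u′ v+t≡v′ = trans (+-distribʳ-max t u v) (cong₂ max u+t≡u′ v+t≡v′)

  -- Balanced (u ⊙ x) says that x lies on the tropical line L_u.
  data Balanced : Pt R → Set where
    low₁ : ∀ {x m} → x ≤ m → Balanced [ x , m , m ]
    low₂ : ∀ {x m} → x ≤ m → Balanced [ m , x , m ]
    low₃ : ∀ {x m} → x ≤ m → Balanced [ m , m , x ]

  pairwiseMax-balanced : ∀ u → Balanced (pairwiseMax u)
  pairwiseMax-balanced [ u₁ , u₂ , u₃ ] = by-largest (total u₁ u₂) (total u₂ u₃) (total u₁ u₃)
    where
    Goal : Set
    Goal = Balanced [ max u₂ u₃ , max u₁ u₃ , max u₁ u₂ ]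

    largest₁ : u₂ ≤ u₁ → u₃ ≤ u₁ → Goal
    largest₁ u₂≤u₁ u₃≤u₁ rewrite y≤x⇒max≡x u₃≤u₁ | y≤x⇒max≡x u₂≤u₁ = low₁ (max-lub u₂≤u₁ u₃≤u₁)

    largest₂ : u₁ ≤ u₂ → u₃ ≤ u₂ → Goal
    largest₂ u₁≤u₂ u₃≤u₂ rewrite y≤x⇒max≡x u₃≤u₂ | x≤y⇒max≡y u₁≤u₂ = low₂ (max-lub u₁≤u₂ u₃≤u₂)

    largest₃ : u₁ ≤ u₃ → u₂ ≤ u₃ → Goal
    largest₃ u₁≤u₃ u₂≤u₃ rewrite x≤y⇒max≡y u₂≤u₃ | x≤y⇒max≡y u₁≤u₃ = low₃ (max-lub u₁≤u₃ u₂≤u₃)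

    by-largest : u₁ ≤ u₂ ⊎ u₂ ≤ u₁ → u₂ ≤ u₃ ⊎ u₃ ≤ u₂ → u₁ ≤ u₃ ⊎ u₃ ≤ u₁ → Goal
    by-largest (inj₂ u₂≤u₁) _            (inj₂ u₃≤u₁) = largest₁ u₂≤u₁ u₃≤u₁
    by-largest (inj₂ u₂≤u₁) _            (inj₁ u₁≤u₃) = largest₃ u₁≤u₃ (≤-trans u₂≤u₁ u₁≤u₃)
    by-largest (inj₁ u₁≤u₂) (inj₂ u₃≤u₂) _            = largest₂ u₁≤u₂ u₃≤u₂
    by-largest (inj₁ u₁≤u₂) (inj₁ u₂≤u₃) _            = largest₃ (≤-trans u₁≤u₂ u₂≤u₃) u₂≤u₃

  ⊗-⊙-balanced : ∀ x y → Balanced ((x ⊗ᴿ y) ⊙ y)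
  ⊗-⊙-balanced x y =
    subst Balanced (sym (⊗-⊙-pairwiseMax x y)) (pairwiseMax-balanced (x ⊙ adjugate y))

  -- Constant (X ⊙ P) says X ≈ₚ −P, and Constant X says X ≈ₚ [0,0,0].
  Trichotomy : Pt R → Pt R → Pt R → Set
  Trichotomy P Q X = Constant (X ⊙ P) ⊎ Constant (X ⊙ Q) ⊎ Constant X

  trichotomy-unrotate : ∀ P Q → Trichotomy (rotate P) (rotate Q) (rotate P ⊗ᴿ rotate Q) →
                        Trichotomy P Q (P ⊗ᴿ Q)
  trichotomy-unrotate P Q t with subst (Trichotomy (rotate P) (rotate Q)) (rotate-⊗ P Q) t
  ... | inj₁ c        = inj₁ (constant-unrotate ((P ⊗ᴿ Q) ⊙ P) c)
  ... | inj₂ (inj₁ c) = inj₂ (inj₁ (constant-unrotate ((P ⊗ᴿ Q) ⊙ Q) c))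
  ... | inj₂ (inj₂ c) = inj₂ (inj₂ (constant-unrotate (P ⊗ᴿ Q) c))

  trichotomy-swap : ∀ P Q → Trichotomy Q P (Q ⊗ᴿ P) → Trichotomy P Q (P ⊗ᴿ Q)
  trichotomy-swap P Q t with subst (Trichotomy Q P) (⊗-comm Q P) t
  ... | inj₁ c        = inj₂ (inj₁ c)
  ... | inj₂ (inj₁ c) = inj₁ c
  ... | inj₂ (inj₂ c) = inj₂ (inj₂ c)

  same-low-⊗ : ∀ x m y n → Trichotomy [ x , m , m ] [ y , n , n ] ([ x , m , m ] ⊗ᴿ [ y , n , n ])
  same-low-⊗ x m y n with total (x + n) (y + m)
  ... | inj₁ x+n≤y+m = inj₂ (inj₁ ((y + m) + n , e , e′ , e′))
    where
    e : max (m + n) (n + m) + y ≡ (y + m) + n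
    e = trans (cong (_+ y) (x≤y⇒max≡y (reflexive (+-comm m n)))) (xy∙z≈zy∙x n m y)
    e′ : max (x + n) (y + m) + n ≡ (y + m) + n
    e′ = cong (_+ n) (x≤y⇒max≡y x+n≤y+m)
  ... | inj₂ y+m≤x+n = inj₁ ((x + n) + m , e , e′ , e′)
    where
    e : max (m + n) (n + m) + x ≡ (x + n) + m
    e = trans (cong (_+ x) (y≤x⇒max≡x (reflexive (+-comm n m)))) (xy∙z≈zy∙x m n x)
    e′ : max (x + n) (y + m) + m ≡ (x + n) + m
    e′ = cong (_+ m) (y≤x⇒max≡x y+m≤x+n)

  low₁-low₂-⊗ : ∀ {x m y n} → x ≤ m → y ≤ n → Constant ([ x , m , m ] ⊗ᴿ [ n , y , n ])
  low₁-low₂-⊗ {x} {m} {y} {n} x≤m y≤n = n + m , e₁ , e₂ , e₃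
    where
    x+n≤n+m : x + n ≤ n + m
    x+n≤n+m = ≤-trans (+-mono-≤ x≤m ≤-refl) (reflexive (+-comm m n))
    e₁ : max (m + n) (y + m) ≡ n + m
    e₁ = trans (cong (λ u → max u (y + m)) (+-comm m n)) (y≤x⇒max≡x (+-mono-≤ y≤n ≤-refl))
    e₂ : max (x + n) (n + m) ≡ n + m
    e₂ = x≤y⇒max≡y x+n≤n+m
    e₃ : max (x + y) (n + m) ≡ n + m
    e₃ = x≤y⇒max≡y (≤-trans (+-mono-≤ ≤-refl y≤n) x+n≤n+m)

  -- Up to the cyclic symmetry of ⊗ and its commutativity there are only two cases.
  balanced-⊗ : ∀ {P Q} → Balanced P → Balanced Q → Trichotomy P Q (P ⊗ᴿ Q)
  balanced-⊗ (low₁ _) (low₁ _) = same-low-⊗ _ _ _ _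
  balanced-⊗ (low₂ _) (low₂ _) = trichotomy-unrotate _ _ (same-low-⊗ _ _ _ _)
  balanced-⊗ (low₃ _) (low₃ _) =
    trichotomy-unrotate _ _ (trichotomy-unrotate _ _ (same-low-⊗ _ _ _ _))
  balanced-⊗ (low₁ p) (low₂ q) = inj₂ (inj₂ (low₁-low₂-⊗ p q))
  balanced-⊗ (low₂ p) (low₃ q) = trichotomy-unrotate _ _ (inj₂ (inj₂ (low₁-low₂-⊗ p q)))
  balanced-⊗ (low₃ p) (low₁ q) =
    trichotomy-unrotate _ _ (trichotomy-unrotate _ _ (inj₂ (inj₂ (low₁-low₂-⊗ p q))))
  balanced-⊗ (low₂ p) (low₁ q) = trichotomy-swap _ _ (inj₂ (inj₂ (low₁-low₂-⊗ q p)))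
  balanced-⊗ (low₃ p) (low₂ q) =
    trichotomy-swap _ _ (trichotomy-unrotate _ _ (inj₂ (inj₂ (low₁-low₂-⊗ q p))))
  balanced-⊗ (low₁ p) (low₃ q) =
    trichotomy-swap _ _
      (trichotomy-unrotate _ _ (trichotomy-unrotate _ _ (inj₂ (inj₂ (low₁-low₂-⊗ q p)))))

  ⊙-adjugate-constant⇒≈ₚ-negₚ : ∀ X r a → Constant ((X ⊙ adjugate a) ⊙ (r ⊙ a)) →
                                _≈ₚ_ R X (negₚ R r)
  ⊙-adjugate-constant⇒≈ₚ-negₚ X r a c = ⊙-constant⇒≈ₚ X (negₚ R r) r
    (constant-⊙-cancelʳ (X ⊙ r) (adjugate a ⊙ a)
      (subst Constant (⊙-interchange X (adjugate a) r a) c)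
      (subst Constant (⊙-comm a (adjugate a)) (⊙-adjugate-constant a)))
    (negₚ-⊙-constant r)

  concurrent-lines-⊗ : ∀ p q a → Balanced (p ⊙ a) → Balanced (q ⊙ a) →
    _≈ₚ_ R (p ⊗ᴿ q) (negₚ R p) ⊎ _≈ₚ_ R (p ⊗ᴿ q) (negₚ R q) ⊎ _≈ₚ_ R (p ⊗ᴿ q) a
  concurrent-lines-⊗ p q a pa qa
    with subst (Trichotomy (p ⊙ a) (q ⊙ a)) (⊗-⊙-adjugate p q a) (balanced-⊗ pa qa)
  ... | inj₁ c        = inj₁ (⊙-adjugate-constant⇒≈ₚ-negₚ (p ⊗ᴿ q) p a c)
  ... | inj₂ (inj₁ c) = inj₂ (inj₁ (⊙-adjugate-constant⇒≈ₚ-negₚ (p ⊗ᴿ q) q a c))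
  ... | inj₂ (inj₂ c) =
    inj₂ (inj₂ (⊙-constant⇒≈ₚ (p ⊗ᴿ q) a (adjugate a) c (⊙-adjugate-constant a)))

corollary1 : (R : RealField) (a b c : Pt R) → NonCollinear R a b c →
    (_≈ₚ_ R (_⊗_ R (_⊗_ R c a) (_⊗_ R a b)) (negₚ R (_⊗_ R c a)))
    ⊎ (_≈ₚ_ R (_⊗_ R (_⊗_ R c a) (_⊗_ R a b)) (negₚ R (_⊗_ R a b)))
    ⊎ (_≈ₚ_ R (_⊗_ R (_⊗_ R c a) (_⊗_ R a b)) a)
corollary1 R a b c _ =
  concurrent-lines-⊗ (c ⊗ᴿ a) (a ⊗ᴿ b) a
    (⊗-⊙-balanced c a)
    (subst (λ q → Balanced (q ⊙ a)) (⊗-comm b a) (⊗-⊙-balanced b a))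
  where open TropicalPlane R
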